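{- Let $p$ be a prime number and $w$ a nonempty word over $[\![p]\!]$. Then the infinite word $(a_{p;w}(n))_{n\in\mathbf N}$ has no prefix of the form $v^{p+1}$ with $|v|=i\,p^{|w|-1}$ for some integer $i\ge p+1$.
   Context: $[\![p]\!]=\{0,\dots,p-1\}$; $v^{p+1}$ is the concatenation of $p+1$ copies of the finite word $v$. For $n\ge0$, $[n]_p$ is the base-$p$ expansion of $n$ without leading zeros, with $[0]_p=0$; $e_{p;w}(n)$ is the number of occurrences of $w$ as a factor (contiguous block, counted at every starting position) of $[n]_p$, and $a_{p;w}(n)\in[\![p]\!]$ with $a_{p;w}(n)\equiv e_{p;w}(n)\pmod p$. -}

module Defs where

open import Data.Nat using (ℕ; zero; suc; _+_; _*_; _∸_; _^_; _≤_; _<_; NonZero)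
open import Data.Nat.DivMod using (_/_; _%_)
open import Data.Nat.Properties using (_≟_)
open import Data.List using (List; []; _∷_; length; map; upTo; concat; replicate; reverse)
open import Data.Bool using (Bool; true; false; if_then_else_)
open import Relation.Nullary.Decidable using (⌊_⌋)
open import Data.List.Properties using (≡-dec)
open import Relation.Binary.PropositionalEquality using (_≡_)

-- Base-p digits, least significant first, of a positive number; the fuel
-- argument (taken to be n itself) bounds the number of steps, which is
-- always sufficient since p ≥ 2.
digitsLSB : (p : ℕ) → .{{_ : NonZero p}} → ℕ → ℕ → List ℕ
digitsLSB p zero    _       = []
digitsLSB p (suc f) zero    = []
digitsLSB p (suc f) (suc m) = (suc m % p) ∷ digitsLSB p f (suc m / p)

expansion : (p : ℕ) → .{{_ : NonZero p}} → ℕ → List ℕ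
expansion p zero    = 0 ∷ []
expansion p (suc m) = reverse (digitsLSB p (suc m) (suc m))

isPrefix : List ℕ → List ℕ → Bool
isPrefix []      _        = true
isPrefix (_ ∷ _) []       = false
isPrefix (x ∷ w) (y ∷ u)  = if ⌊ x ≟ y ⌋ then isPrefix w u else false

occurrences : List ℕ → List ℕ → ℕ
occurrences w []        = if isPrefix w [] then 1 else 0
occurrences w (y ∷ u)   = (if isPrefix w (y ∷ u) then 1 else 0) + occurrences w u

e : (p : ℕ) → .{{_ : NonZero p}} → List ℕ → ℕ → ℕ
e p w n = occurrences w (expansion p n)

a : (p : ℕ) → .{{_ : NonZero p}} → List ℕ → ℕ → ℕ
a p w n = e p w n % p

pow : List ℕ → ℕ → List ℕ
pow v k = concat (replicate k v)

HasPrefix : (ℕ → ℕ) → List ℕ → Set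
HasPrefix f u = map f (upTo (length u)) ≡ u

-- Removing the last digit gives e N = e (N / p) + [w is a suffix of [N]_p].
-- A prefix v^(p+1) of a with |v| = L = i p^(|w|-1) makes e (L + n) ≡ e n (mod p) for n < pL, so e sums
-- to 0 mod p over every window of length pL starting at some T ≤ L. When T is a multiple of p, the
-- recurrence turns this into: the number of N in the window of which w is a suffix is ≡ 0 (mod p).
-- The window starting at p^|w| contains exactly i such N, and the one starting at 0 contains i, or i - 1
-- when w is 0 followed by a nonempty word. In the second case p divides both i and i - 1. In the first,
-- p ∣ i, and since being a suffix is then periodic modulo p^|w|, the period descends from L to L / p,
-- which cannot go on forever. For w = 0 the recurrence fails at N = 0; there e (Lp) = e L + 1 contradicts
-- e (Lp) ≡ e L.

module Submission where

open import Defs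
open import Data.Bool using (Bool; true; false; if_then_else_)
open import Data.Empty using (⊥-elim)
open import Data.List using (List; []; _∷_; _++_; _∷ʳ_; length; reverse; applyUpTo)
open import Data.List.Properties
  using (≡-dec; ∷-injective; ∷-injectiveˡ; ∷-injectiveʳ; length-++; length-reverse; ++-assoc; ++-identityʳ;
         map-upTo; reverse-++; unfold-reverse; reverse-injective)
open import Data.List.Relation.Unary.All using (All; []; _∷_)
open import Data.List.Relation.Binary.Permutation.Propositional using (↭-sym)
open import Data.List.Relation.Binary.Permutation.Propositional.Properties using (All-resp-↭; ↭-reverse)
open import Data.Nat
open import Data.Nat.Properties
open import Data.Nat.DivMod
open import Data.Nat.Divisibility using (n∣m*n; m∣m*n; ∣-trans)
open import Data.Nat.Induction using (<-rec)
open import Data.Nat.Primality using (Prime; prime⇒nonTrivial)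
open import Data.Nat.Solver using (module +-*-Solver)
open import Data.Product using (_,_; _×_; proj₁; proj₂; ∃-syntax)
open import Function using (case_of_)
open import Relation.Binary.PropositionalEquality
open import Relation.Nullary using (¬_; Dec; yes; no)
open import Relation.Nullary.Decidable using (⌊_⌋)

open +-*-Solver

χ : Bool → ℕ
χ b = if b then 1 else 0

χ-if : ∀ b c → χ (if b then c else false) ≡ (if b then χ c else 0)
χ-if true  c = refl
χ-if false c = refl

if-same : ∀ b → (if b then 0 else 0) ≡ 0
if-same true  = refl
if-same false = refl

if-yes : ∀ {A : Set} (a? : Dec A) {m n : ℕ} → A → (if ⌊ a? ⌋ then m else n) ≡ m
if-yes (yes _)  _ = refl
if-yes (no ¬a)  a = ⊥-elim (¬a a)

if-no : ∀ {A : Set} (a? : Dec A) {m n : ℕ} → ¬ A → (if ⌊ a? ⌋ then m else n) ≡ n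
if-no  (yes a)  ¬a = ⊥-elim (¬a a)
if-no  (no _)   _  = refl

eqᴺ : List ℕ → List ℕ → ℕ
eqᴺ []      []      = 1
eqᴺ (x ∷ u) (y ∷ v) = if ⌊ x ≟ y ⌋ then eqᴺ u v else 0
eqᴺ _       _       = 0

eqᴺ-refl : ∀ u → eqᴺ u u ≡ 1
eqᴺ-refl []      = refl
eqᴺ-refl (x ∷ u) with x ≟ x
... | yes _   = eqᴺ-refl u
... | no x≢x  = ⊥-elim (x≢x refl)

eqᴺ-≢ : ∀ u v → ¬ u ≡ v → eqᴺ u v ≡ 0
eqᴺ-≢ []      []      u≢v = ⊥-elim (u≢v refl)
eqᴺ-≢ []      (_ ∷ _) _   = refl
eqᴺ-≢ (_ ∷ _) []      _   = refl
eqᴺ-≢ (x ∷ u) (y ∷ v) u≢v with x ≟ y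
... | no _     = refl
... | yes refl = eqᴺ-≢ u v (λ u≡v → u≢v (cong (x ∷_) u≡v))

eqᴺ-reverse : ∀ u v → eqᴺ u v ≡ eqᴺ (reverse u) (reverse v)
eqᴺ-reverse u v with ≡-dec _≟_ u v
... | yes refl = trans (eqᴺ-refl u) (sym (eqᴺ-refl (reverse u)))
... | no u≢v   = trans (eqᴺ-≢ u v u≢v) (sym (eqᴺ-≢ _ _ (λ eq → u≢v (reverse-injective eq))))

isPrefix-∷ʳ : ∀ r v z → χ (isPrefix r (v ∷ʳ z)) ≡ χ (isPrefix r v) + eqᴺ r (v ∷ʳ z)
isPrefix-∷ʳ []      []      z = refl
isPrefix-∷ʳ []      (_ ∷ _) z = refl
isPrefix-∷ʳ (x ∷ r) []      z with x ≟ z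
... | no _ = refl
isPrefix-∷ʳ (x ∷ []) []      z | yes _ = refl
isPrefix-∷ʳ (x ∷ _ ∷ _) []   z | yes _ = refl
isPrefix-∷ʳ (x ∷ r) (y ∷ v) z with x ≟ y
... | no _  = refl
... | yes _ = isPrefix-∷ʳ r v z

isPrefix-[] : ∀ w → ¬ w ≡ [] → isPrefix w [] ≡ false
isPrefix-[] []      w≢[] = ⊥-elim (w≢[] refl)
isPrefix-[] (_ ∷ _) _    = refl

occurrences-∷ʳ : ∀ w → ¬ w ≡ [] → ∀ u d →
  occurrences w (u ∷ʳ d) ≡ occurrences w u + χ (isPrefix (reverse w) (d ∷ reverse u))
occurrences-∷ʳ w w≢[] [] d = begin
  χ (isPrefix w ([] ∷ʳ d)) + χ (isPrefix w [])  ≡⟨ cong₂ _+_ (isPrefix-∷ʳ w [] d) w∉[] ⟩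
  (χ (isPrefix w []) + eqᴺ w (d ∷ [])) + 0      ≡⟨ +-identityʳ _ ⟩
  χ (isPrefix w []) + eqᴺ w (d ∷ [])            ≡⟨ cong₂ _+_ (trans w∉[] (sym rw∉[])) (eqᴺ-reverse w (d ∷ [])) ⟩
  χ (isPrefix rw []) + eqᴺ rw (d ∷ [])          ≡⟨ isPrefix-∷ʳ rw [] d ⟨
  χ (isPrefix rw (d ∷ []))                      ≡⟨ cong (_+ χ (isPrefix rw (d ∷ []))) w∉[] ⟨
  χ (isPrefix w []) + χ (isPrefix rw (d ∷ []))  ∎
  where
  open ≡-Reasoning
  rw = reverse w
  w∉[] : χ (isPrefix w []) ≡ 0
  w∉[] = cong χ (isPrefix-[] w w≢[])
  rw∉[] : χ (isPrefix rw []) ≡ 0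
  rw∉[] = cong χ (isPrefix-[] rw (λ rw≡[] → w≢[] (reverse-injective rw≡[])))
occurrences-∷ʳ w w≢[] (y ∷ u) d = begin
  χ (isPrefix w ((y ∷ u) ∷ʳ d)) + occurrences w (u ∷ʳ d)
    ≡⟨ cong₂ _+_ (isPrefix-∷ʳ w (y ∷ u) d) (occurrences-∷ʳ w w≢[] u d) ⟩
  (A + eqᴺ w ((y ∷ u) ∷ʳ d)) + (O + B)
    ≡⟨ cong (λ n → (A + n) + (O + B)) (trans (eqᴺ-reverse w _) (cong (eqᴺ rw) reverse-∷ʳ)) ⟩
  (A + eqᴺ rw ((d ∷ reverse u) ∷ʳ y)) + (O + B)
    ≡⟨ solve 4 (λ a e o b → (a :+ e) :+ (o :+ b) := (a :+ o) :+ (b :+ e)) refl A (eqᴺ rw _) O B ⟩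
  (A + O) + (B + eqᴺ rw ((d ∷ reverse u) ∷ʳ y))
    ≡⟨ cong ((A + O) +_) (isPrefix-∷ʳ rw (d ∷ reverse u) y) ⟨
  (A + O) + χ (isPrefix rw ((d ∷ reverse u) ∷ʳ y))
    ≡⟨ cong (λ t → (A + O) + χ (isPrefix rw (d ∷ t))) (unfold-reverse y u) ⟨
  (A + O) + χ (isPrefix rw (d ∷ reverse (y ∷ u)))  ∎
  where
  open ≡-Reasoning
  rw = reverse w
  A = χ (isPrefix w (y ∷ u))
  O = occurrences w u
  B = χ (isPrefix rw (d ∷ reverse u))
  reverse-∷ʳ : reverse ((y ∷ u) ∷ʳ d) ≡ (d ∷ reverse u) ∷ʳ y
  reverse-∷ʳ = trans (reverse-++ (y ∷ u) (d ∷ [])) (cong (d ∷_) (unfold-reverse y u))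

applyUpTo-++ : ∀ (f : ℕ → ℕ) u s → applyUpTo f (length u + length s) ≡ u ++ s →
               applyUpTo f (length u) ≡ u × applyUpTo (λ n → f (length u + n)) (length s) ≡ s
applyUpTo-++ f []      s eq = refl , eq
applyUpTo-++ f (x ∷ u) s eq =
  let f0≡x , rest           = ∷-injective eq
      prefix , shiftedRest  = applyUpTo-++ (λ n → f (suc n)) u s rest
  in cong₂ _∷_ f0≡x prefix , shiftedRest

applyUpTo-≡-pointwise : ∀ {f g : ℕ → ℕ} n → applyUpTo f n ≡ applyUpTo g n → ∀ {j} → j < n → f j ≡ g j
applyUpTo-≡-pointwise (suc n) eq {zero}  _         = ∷-injectiveˡ eq
applyUpTo-≡-pointwise (suc n) eq {suc j} (s≤s j<n) = applyUpTo-≡-pointwise n (∷-injectiveʳ eq) j<n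

pow-suc-++ : ∀ v k → pow v (suc k) ≡ pow v k ++ v
pow-suc-++ v zero    = ++-identityʳ v
pow-suc-++ v (suc k) = trans (cong (v ++_) (pow-suc-++ v k)) (sym (++-assoc v (pow v k) v))

length-pow : ∀ v k → length (pow v k) ≡ k * length v
length-pow v zero    = refl
length-pow v (suc k) = trans (length-++ v) (cong (length v +_) (length-pow v k))

-- The prefix is read once as v followed by v^k and once as v^k followed by v.
HasPrefix-pow⇒periodic : ∀ (f : ℕ → ℕ) v k → HasPrefix f (pow v (suc k)) →
                         ∀ n → n < k * length v → f (length v + n) ≡ f n
HasPrefix-pow⇒periodic f v k prefix n n<kv =
  applyUpTo-≡-pointwise (length (pow v k)) (trans shifted (sym unshifted)) (subst (n <_) (sym (length-pow v k)) n<kv)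
  where
  whole : ∀ u → pow v (suc k) ≡ u → applyUpTo f (length u) ≡ u
  whole u refl = trans (sym (map-upTo f _)) prefix
  shifted : applyUpTo (λ j → f (length v + j)) (length (pow v k)) ≡ pow v k
  shifted = proj₂ (applyUpTo-++ f v (pow v k) (subst (λ l → applyUpTo f l ≡ v ++ pow v k) (length-++ v) (whole (v ++ pow v k) refl)))
  unshifted : applyUpTo f (length (pow v k)) ≡ pow v k
  unshifted = proj₁ (applyUpTo-++ f (pow v k) v
                (subst (λ l → applyUpTo f l ≡ pow v k ++ v) (length-++ (pow v k)) (whole (pow v k ++ v) (pow-suc-++ v k))))

∑ : ℕ → (ℕ → ℕ) → ℕ
∑ zero    f = 0
∑ (suc n) f = ∑ n f + f n

∑-cong : ∀ n {f g} → (∀ j → j < n → f j ≡ g j) → ∑ n f ≡ ∑ n g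
∑-cong zero    f≡g = refl
∑-cong (suc n) f≡g = cong₂ _+_ (∑-cong n (λ j j<n → f≡g j (m<n⇒m<1+n j<n))) (f≡g n ≤-refl)

∑-+ : ∀ m n f → ∑ (m + n) f ≡ ∑ m f + ∑ n (λ j → f (m + j))
∑-+ m zero    f = trans (cong (λ k → ∑ k f) (+-identityʳ m)) (sym (+-identityʳ _))
∑-+ m (suc n) f rewrite +-suc m n | ∑-+ m n f = +-assoc (∑ m f) _ _

∑-* : ∀ a b f → ∑ (a * b) f ≡ ∑ a (λ q → ∑ b (λ d → f (q * b + d)))
∑-* zero    b f = refl
∑-* (suc a) b f = begin
  ∑ (b + a * b) f                                        ≡⟨ cong (λ n → ∑ n f) (+-comm b (a * b)) ⟩
  ∑ (a * b + b) f                                        ≡⟨ ∑-+ (a * b) b f ⟩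
  ∑ (a * b) f + ∑ b (λ d → f (a * b + d))                ≡⟨ cong (_+ ∑ b (λ d → f (a * b + d))) (∑-* a b f) ⟩
  ∑ a (λ q → ∑ b (λ d → f (q * b + d))) + ∑ b (λ d → f (a * b + d)) ∎
  where open ≡-Reasoning

∑-distrib : ∀ n f g → ∑ n (λ j → f j + g j) ≡ ∑ n f + ∑ n g
∑-distrib zero    f g = refl
∑-distrib (suc n) f g rewrite ∑-distrib n f g =
  solve 4 (λ a b c d → (a :+ b) :+ (c :+ d) := (a :+ c) :+ (b :+ d)) refl (∑ n f) (∑ n g) (f n) (g n)

∑-const : ∀ n c → ∑ n (λ _ → c) ≡ n * c
∑-const zero    c = refl
∑-const (suc n) c rewrite ∑-const n c = +-comm (n * c) c

∑-suc : ∀ n f → ∑ (suc n) f ≡ f 0 + ∑ n (λ j → f (suc j))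
∑-suc zero    f = +-comm 0 (f 0)
∑-suc (suc n) f rewrite ∑-suc n f = +-assoc (f 0) _ _

∑-indicator : ∀ n x (f : ℕ → ℕ) → x < n → ∑ n (λ d → if ⌊ x ≟ d ⌋ then f d else 0) ≡ f x
∑-indicator (suc n) x f x<1+n with x ≟ n
... | yes refl = cong (_+ f x) (vanish x ≤-refl)
  where
  vanish : ∀ m → m ≤ x → ∑ m (λ d → if ⌊ x ≟ d ⌋ then f d else 0) ≡ 0
  vanish zero    _   = refl
  vanish (suc m) m<x with x ≟ m
  ... | yes refl = ⊥-elim (n≮n x m<x)
  ... | no _     = trans (+-identityʳ _) (vanish m (≤-trans (n≤1+n m) m<x))
... | no x≢n   = trans (+-identityʳ _) (∑-indicator n x f (≤∧≢⇒< (s≤s⁻¹ x<1+n) x≢n))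

∑-exchange-first : ∀ n (g h : ℕ → ℕ) → 0 < n → (∀ q → g (suc q) ≡ h (suc q)) → ∑ n g + h 0 ≡ ∑ n h + g 0
∑-exchange-first (suc n) g h _ g≡h = begin
  ∑ (suc n) g + h 0                          ≡⟨ cong (_+ h 0) (∑-suc n g) ⟩
  (g 0 + ∑ n (λ q → g (suc q))) + h 0        ≡⟨ cong (λ t → (g 0 + t) + h 0) (∑-cong n (λ q _ → g≡h q)) ⟩
  (g 0 + ∑ n (λ q → h (suc q))) + h 0        ≡⟨ solve 3 (λ a s b → (a :+ s) :+ b := (b :+ s) :+ a) refl (g 0) _ (h 0) ⟩
  (h 0 + ∑ n (λ q → h (suc q))) + g 0        ≡⟨ cong (_+ g 0) (∑-suc n h) ⟨
  ∑ (suc n) h + g 0                          ∎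
  where open ≡-Reasoning

module Congruence (p : ℕ) .{{_ : NonZero p}} where

  infix 4 _≈_
  _≈_ : ℕ → ℕ → Set
  m ≈ n = m % p ≡ n % p

  +-≈ : ∀ {a b c d} → a ≈ b → c ≈ d → a + c ≈ b + d
  +-≈ {a} {b} {c} {d} a≈b c≈d = begin
    (a + c) % p          ≡⟨ %-distribˡ-+ a c p ⟩
    (a % p + c % p) % p  ≡⟨ cong₂ (λ m n → (m + n) % p) a≈b c≈d ⟩
    (b % p + d % p) % p  ≡⟨ %-distribˡ-+ b d p ⟨
    (b + d) % p          ∎
    where open ≡-Reasoning

  ∑-≈ : ∀ n {f g} → (∀ j → j < n → f j ≈ g j) → ∑ n f ≈ ∑ n g
  ∑-≈ zero    f≈g = refl
  ∑-≈ (suc n) f≈g = +-≈ (∑-≈ n (λ j j<n → f≈g j (m<n⇒m<1+n j<n))) (f≈g n ≤-refl)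

  p*-≈0 : ∀ x → p * x ≈ 0
  p*-≈0 x = trans (cong (_% p) (*-comm p x)) (trans (m*n%n≡0 x p) (sym (0%p)))
    where
    0%p : 0 % p ≡ 0
    0%p = m<n⇒m%n≡m (>-nonZero⁻¹ p)

  1≉0 : 1 < p → ¬ 1 ≈ 0
  1≉0 1<p 1≈0 with trans (sym (m<n⇒m%n≡m 1<p)) (trans 1≈0 (m<n⇒m%n≡m (>-nonZero⁻¹ p)))
  ... | ()

  +-cancelʳ-≈ : ∀ a b c → a + c ≈ b + c → a ≈ b
  +-cancelʳ-≈ a b c a+c≈b+c = begin
    a % p                          ≡⟨ [m+kn]%n≡m%n a c p ⟨
    (a + c * p) % p                ≡⟨ cong (_% p) (regroup a) ⟩
    ((a + c) + c * (p ∸ 1)) % p    ≡⟨ +-≈ a+c≈b+c refl ⟩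
    ((b + c) + c * (p ∸ 1)) % p    ≡⟨ cong (_% p) (regroup b) ⟨
    (b + c * p) % p                ≡⟨ [m+kn]%n≡m%n b c p ⟩
    b % p                          ∎
    where
    open ≡-Reasoning
    regroup : ∀ z → z + c * p ≡ (z + c) + c * (p ∸ 1)
    regroup z = begin
      z + c * p                ≡⟨ cong (λ n → z + c * n) (sym (suc-pred p)) ⟩
      z + c * suc (p ∸ 1)      ≡⟨ solve 3 (λ z c q → z :+ c :* (con 1 :+ q) := (z :+ c) :+ c :* q) refl z c (p ∸ 1) ⟩
      (z + c) + c * (p ∸ 1)    ∎

module Digits (p : ℕ) .{{_ : NonZero p}} (1<p : 1 < p) where

  0<p : 0 < p
  0<p = <-trans z<s 1<p

  remainder-digit : ∀ Q d → d < p → (Q * p + d) % p ≡ d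
  remainder-digit Q d d<p = trans (%-remove-+ˡ d (n∣m*n Q)) (m<n⇒m%n≡m d<p)

  quotient-digit : ∀ Q d → d < p → (Q * p + d) / p ≡ Q
  quotient-digit Q d d<p = begin
    (Q * p + d) / p    ≡⟨ +-distrib-/-∣ˡ d (n∣m*n Q) ⟩
    Q * p / p + d / p  ≡⟨ cong₂ _+_ (m*n/n≡m Q p) (m<n⇒m/n≡0 d<p) ⟩
    Q + 0              ≡⟨ +-identityʳ Q ⟩
    Q                  ∎
    where open ≡-Reasoning

  quotient-+ : ∀ N k → (N + k * p) / p ≡ N / p + k
  quotient-+ N k = trans (+-distrib-/-∣ʳ N (n∣m*n k)) (cong (N / p +_) (m*n/n≡m k p))

  digitsLSB-fuel : ∀ f g n → n ≤ f → n ≤ g → digitsLSB p f n ≡ digitsLSB p g n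
  digitsLSB-fuel zero    zero    zero    _         _         = refl
  digitsLSB-fuel zero    (suc g) zero    _         _         = refl
  digitsLSB-fuel (suc f) zero    zero    _         _         = refl
  digitsLSB-fuel (suc f) (suc g) zero    _         _         = refl
  digitsLSB-fuel (suc f) (suc g) (suc n) (s≤s n≤f) (s≤s n≤g) =
    cong (suc n % p ∷_) (digitsLSB-fuel f g (suc n / p) (≤-trans q≤n n≤f) (≤-trans q≤n n≤g))
    where
    q≤n : suc n / p ≤ n
    q≤n = s≤s⁻¹ (m/n<m (suc n) p 1<p)

  expansion-< : ∀ N → N < p → expansion p N ≡ N ∷ []
  expansion-< zero    _   = refl
  expansion-< (suc n) N<p
    rewrite m<n⇒m/n≡0 N<p | m<n⇒m%n≡m N<p with n
  ... | zero  = refl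
  ... | suc _ = refl

  expansion-digitsLSB : ∀ f q → 0 < q → q ≤ f → expansion p q ≡ reverse (digitsLSB p f q)
  expansion-digitsLSB f (suc q) _ q≤f = cong reverse (digitsLSB-fuel (suc q) f (suc q) ≤-refl q≤f)

  expansion-≥ : ∀ N → p ≤ N → expansion p N ≡ expansion p (N / p) ∷ʳ N % p
  expansion-≥ zero    p≤0 = ⊥-elim (<⇒≱ 0<p p≤0)
  expansion-≥ (suc n) p≤N = begin
    reverse (suc n % p ∷ digitsLSB p n (suc n / p))  ≡⟨ unfold-reverse (suc n % p) (digitsLSB p n (suc n / p)) ⟩
    reverse (digitsLSB p n (suc n / p)) ∷ʳ suc n % p ≡⟨ cong (_∷ʳ suc n % p) (expansion-digitsLSB n (suc n / p) 0<q q≤n) ⟨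
    expansion p (suc n / p) ∷ʳ suc n % p             ∎
    where
    open ≡-Reasoning
    0<q : 0 < suc n / p
    0<q = m≥n⇒m/n>0 p≤N
    q≤n : suc n / p ≤ n
    q≤n = s≤s⁻¹ (m/n<m (suc n) p 1<p)

  reverse-expansion-< : ∀ N → N < p → reverse (expansion p N) ≡ N ∷ []
  reverse-expansion-< N N<p = cong reverse (expansion-< N N<p)

  reverse-expansion-≥ : ∀ N → p ≤ N → reverse (expansion p N) ≡ N % p ∷ reverse (expansion p (N / p))
  reverse-expansion-≥ N p≤N =
    trans (cong reverse (expansion-≥ N p≤N)) (reverse-++ (expansion p (N / p)) (N % p ∷ []))

  -- r lists a word from its last letter: suffixᵣ (reverse w) N is 1 if w is a suffix of [N]_p, else 0.
  -- suffixᵣ⁺ r N checks r against the digits of N / p, which exist only when p ≤ N.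
  mutual
    suffixᵣ : List ℕ → ℕ → ℕ
    suffixᵣ []      N = 1
    suffixᵣ (x ∷ r) N = if ⌊ x ≟ N % p ⌋ then suffixᵣ⁺ r N else 0

    suffixᵣ⁺ : List ℕ → ℕ → ℕ
    suffixᵣ⁺ []      N = 1
    suffixᵣ⁺ (y ∷ r) N = if ⌊ p ≤? N ⌋ then suffixᵣ (y ∷ r) (N / p) else 0

  isPrefix-reverse-expansion : ∀ r N → χ (isPrefix r (reverse (expansion p N))) ≡ suffixᵣ r N
  isPrefix-reverse-expansion []      N = refl
  isPrefix-reverse-expansion (x ∷ r) N with p ≤? N
  ... | yes p≤N = begin
    χ (isPrefix (x ∷ r) (reverse (expansion p N)))
      ≡⟨ cong (λ u → χ (isPrefix (x ∷ r) u)) (reverse-expansion-≥ N p≤N) ⟩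
    χ (if ⌊ x ≟ N % p ⌋ then isPrefix r (reverse (expansion p (N / p))) else false)
      ≡⟨ χ-if ⌊ x ≟ N % p ⌋ _ ⟩
    (if ⌊ x ≟ N % p ⌋ then χ (isPrefix r (reverse (expansion p (N / p)))) else 0)
      ≡⟨ cong (λ n → if ⌊ x ≟ N % p ⌋ then n else 0) (higher r) ⟩
    suffixᵣ (x ∷ r) N ∎
    where
    open ≡-Reasoning
    higher : ∀ r → χ (isPrefix r (reverse (expansion p (N / p)))) ≡ suffixᵣ⁺ r N
    higher []      = refl
    higher (y ∷ r) = trans (isPrefix-reverse-expansion (y ∷ r) (N / p)) (sym (if-yes (p ≤? N) p≤N))
  ... | no p≰N = begin
    χ (isPrefix (x ∷ r) (reverse (expansion p N)))
      ≡⟨ cong (λ u → χ (isPrefix (x ∷ r) u)) (reverse-expansion-< N N<p) ⟩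
    χ (if ⌊ x ≟ N ⌋ then isPrefix r [] else false)
      ≡⟨ χ-if ⌊ x ≟ N ⌋ _ ⟩
    (if ⌊ x ≟ N ⌋ then χ (isPrefix r []) else 0)
      ≡⟨ cong₂ (λ n t → if ⌊ x ≟ n ⌋ then t else 0) (sym (m<n⇒m%n≡m N<p)) (higher r) ⟩
    suffixᵣ (x ∷ r) N ∎
    where
    open ≡-Reasoning
    N<p = ≰⇒> p≰N
    higher : ∀ r → χ (isPrefix r []) ≡ suffixᵣ⁺ r N
    higher []      = refl
    higher (y ∷ r) = sym (if-no (p ≤? N) p≰N)

  module Occurrences (w : List ℕ) (w≢[] : ¬ w ≡ []) where

    e-< : ∀ N → N < p → e p w N ≡ suffixᵣ (reverse w) N
    e-< N N<p = begin
      occurrences w (expansion p N)                     ≡⟨ cong (occurrences w) (expansion-< N N<p) ⟩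
      occurrences w ([] ∷ʳ N)                           ≡⟨ occurrences-∷ʳ w w≢[] [] N ⟩
      χ (isPrefix w []) + χ (isPrefix (reverse w) (N ∷ []))
        ≡⟨ cong₂ _+_ (cong χ (isPrefix-[] w w≢[])) (cong (λ u → χ (isPrefix (reverse w) u)) (sym (reverse-expansion-< N N<p))) ⟩
      0 + χ (isPrefix (reverse w) (reverse (expansion p N)))  ≡⟨ isPrefix-reverse-expansion (reverse w) N ⟩
      suffixᵣ (reverse w) N                             ∎
      where open ≡-Reasoning

    e-≥ : ∀ N → p ≤ N → e p w N ≡ e p w (N / p) + suffixᵣ (reverse w) N
    e-≥ N p≤N = begin
      occurrences w (expansion p N)                        ≡⟨ cong (occurrences w) (expansion-≥ N p≤N) ⟩
      occurrences w (expansion p (N / p) ∷ʳ N % p)         ≡⟨ occurrences-∷ʳ w w≢[] (expansion p (N / p)) (N % p) ⟩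
      e p w (N / p) + χ (isPrefix (reverse w) (N % p ∷ reverse (expansion p (N / p))))
        ≡⟨ cong (λ u → e p w (N / p) + χ (isPrefix (reverse w) u)) (reverse-expansion-≥ N p≤N) ⟨
      e p w (N / p) + χ (isPrefix (reverse w) (reverse (expansion p N)))
        ≡⟨ cong (e p w (N / p) +_) (isPrefix-reverse-expansion (reverse w) N) ⟩
      e p w (N / p) + suffixᵣ (reverse w) N                ∎
      where open ≡-Reasoning

    e-digit : suffixᵣ (reverse w) 0 ≡ 0 →
              ∀ Q d → d < p → e p w (Q * p + d) ≡ e p w Q + suffixᵣ (reverse w) (Q * p + d)
    e-digit s0≡0 zero    d d<p = trans (e-< d d<p) (cong (_+ suffixᵣ (reverse w) d) (sym (trans (e-< 0 0<p) s0≡0)))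
    e-digit s0≡0 (suc Q) d d<p =
      trans (e-≥ (suc Q * p + d) (≤-trans (m≤m+n p (Q * p)) (m≤m+n _ d)))
            (cong (λ n → e p w n + suffixᵣ (reverse w) (suc Q * p + d)) (quotient-digit (suc Q) d d<p))

  suffixᵣ-digit : ∀ x r Q d → d < p →
                  suffixᵣ (x ∷ r) (Q * p + d) ≡ (if ⌊ x ≟ d ⌋ then suffixᵣ⁺ r (Q * p + d) else 0)
  suffixᵣ-digit x r Q d d<p = cong (λ n → if ⌊ x ≟ n ⌋ then suffixᵣ⁺ r (Q * p + d) else 0) (remainder-digit Q d d<p)

  suffixᵣ⁺-digit : ∀ r Q d → 0 < Q → d < p → suffixᵣ⁺ r (Q * p + d) ≡ suffixᵣ r Q
  suffixᵣ⁺-digit []      Q d _   _   = refl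
  suffixᵣ⁺-digit (y ∷ r) Q d 0<Q d<p = begin
    (if ⌊ p ≤? Q * p + d ⌋ then suffixᵣ (y ∷ r) ((Q * p + d) / p) else 0) ≡⟨ if-yes (p ≤? Q * p + d) p≤N ⟩
    suffixᵣ (y ∷ r) ((Q * p + d) / p)                                      ≡⟨ cong (suffixᵣ (y ∷ r)) (quotient-digit Q d d<p) ⟩
    suffixᵣ (y ∷ r) Q                                                      ∎
    where
    open ≡-Reasoning
    p≤N : p ≤ Q * p + d
    p≤N = ≤-trans (m≤n*m p Q {{>-nonZero 0<Q}}) (m≤m+n (Q * p) d)

  suffixᵣ⁺-< : ∀ y r N → N < p → suffixᵣ⁺ (y ∷ r) N ≡ 0
  suffixᵣ⁺-< y r N N<p = if-no (p ≤? N) (<⇒≱ N<p)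

  ∑-suffixᵣ-digit : ∀ x r Q → x < p → ∑ p (λ d → suffixᵣ (x ∷ r) (Q * p + d)) ≡ suffixᵣ⁺ r (Q * p + x)
  ∑-suffixᵣ-digit x r Q x<p =
    trans (∑-cong p (λ d d<p → suffixᵣ-digit x r Q d d<p)) (∑-indicator p x (λ d → suffixᵣ⁺ r (Q * p + d)) x<p)

  ∑-digits : ∀ K n f → ∑ (p * n) (λ j → f (K * (p * n) + j)) ≡ ∑ n (λ q → ∑ p (λ d → f ((K * n + q) * p + d)))
  ∑-digits K n f = begin
    ∑ (p * n) g                                   ≡⟨ cong (λ k → ∑ k g) (*-comm p n) ⟩
    ∑ (n * p) g                                   ≡⟨ ∑-* n p g ⟩
    ∑ n (λ q → ∑ p (λ d → g (q * p + d)))         ≡⟨ ∑-cong n (λ q _ → ∑-cong p (λ d _ → cong f (regroup q d))) ⟩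
    ∑ n (λ q → ∑ p (λ d → f ((K * n + q) * p + d))) ∎
    where
    open ≡-Reasoning
    g = λ j → f (K * (p * n) + j)
    regroup : ∀ q d → K * (p * n) + (q * p + d) ≡ (K * n + q) * p + d
    regroup q d = solve 5 (λ K p n q d → K :* (p :* n) :+ (q :* p :+ d) := (K :* n :+ q) :* p :+ d) refl K p n q d

  ∑-suffixᵣ-block : ∀ r → All (_< p) r → ∀ K → 0 < K → ∑ (p ^ length r) (λ j → suffixᵣ r (K * p ^ length r + j)) ≡ 1
  ∑-suffixᵣ-block []      _           K _   = refl
  ∑-suffixᵣ-block (x ∷ r) (x<p ∷ r<p) K 0<K = begin
    ∑ (p * P) (λ j → suffixᵣ (x ∷ r) (K * (p * P) + j))
      ≡⟨ ∑-digits K P (suffixᵣ (x ∷ r)) ⟩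
    ∑ P (λ q → ∑ p (λ d → suffixᵣ (x ∷ r) ((K * P + q) * p + d)))
      ≡⟨ ∑-cong P (λ q _ → ∑-suffixᵣ-digit x r (K * P + q) x<p) ⟩
    ∑ P (λ q → suffixᵣ⁺ r ((K * P + q) * p + x))
      ≡⟨ ∑-cong P (λ q _ → suffixᵣ⁺-digit r (K * P + q) x (0<KP+q q) x<p) ⟩
    ∑ P (λ q → suffixᵣ r (K * P + q))
      ≡⟨ ∑-suffixᵣ-block r r<p K 0<K ⟩
    1 ∎
    where
    open ≡-Reasoning
    P = p ^ length r
    0<KP+q : ∀ q → 0 < K * P + q
    0<KP+q q = <-≤-trans (>-nonZero⁻¹ (K * P) {{m*n≢0 K P {{>-nonZero 0<K}} {{m^n≢0 p (length r)}}}}) (m≤m+n (K * P) q)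

  -- Grouping j by its quotient q = j / p, the group of q ≥ 1 contributes suffixᵣ r q,
  -- and the group of q = 0 contributes suffixᵣ⁺ r x.
  ∑-suffixᵣ-∷ : ∀ x r → x < p →
    ∑ (p ^ length (x ∷ r)) (suffixᵣ (x ∷ r)) + suffixᵣ r 0 ≡ ∑ (p ^ length r) (suffixᵣ r) + suffixᵣ⁺ r x
  ∑-suffixᵣ-∷ x r x<p = begin
    ∑ (p * P) (suffixᵣ (x ∷ r)) + suffixᵣ r 0
      ≡⟨ cong (_+ suffixᵣ r 0) (∑-digits 0 P (suffixᵣ (x ∷ r))) ⟩
    ∑ P (λ q → ∑ p (λ d → suffixᵣ (x ∷ r) (q * p + d))) + suffixᵣ r 0
      ≡⟨ cong (_+ suffixᵣ r 0) (∑-cong P (λ q _ → ∑-suffixᵣ-digit x r q x<p)) ⟩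
    ∑ P (λ q → suffixᵣ⁺ r (q * p + x)) + suffixᵣ r 0
      ≡⟨ ∑-exchange-first P _ (suffixᵣ r) (m^n>0 p (length r)) (λ q → suffixᵣ⁺-digit r (suc q) x z<s x<p) ⟩
    ∑ P (suffixᵣ r) + suffixᵣ⁺ r x ∎
    where
    open ≡-Reasoning
    P = p ^ length r

  -- deficit (reverse w) is 1 when w is 0 followed by a nonempty word, and 0 otherwise.
  deficit : List ℕ → ℕ
  deficit []          = 0
  deficit (x ∷ [])    = 0
  deficit (x ∷ y ∷ r) = suffixᵣ (y ∷ r) 0 + deficit (y ∷ r)

  ∑-suffixᵣ-initial : ∀ r → All (_< p) r → ∑ (p ^ length r) (suffixᵣ r) + deficit r ≡ 1
  ∑-suffixᵣ-initial []          _                 = refl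
  ∑-suffixᵣ-initial (x ∷ [])    (x<p ∷ [])        =
    trans (+-identityʳ _) (+-cancelʳ-≡ 1 _ 1 (∑-suffixᵣ-∷ x [] x<p))
  ∑-suffixᵣ-initial (x ∷ y ∷ r) (x<p ∷ y∷r<p)    = begin
    S + (suffixᵣ (y ∷ r) 0 + deficit (y ∷ r))    ≡⟨ +-assoc S (suffixᵣ (y ∷ r) 0) (deficit (y ∷ r)) ⟨
    (S + suffixᵣ (y ∷ r) 0) + deficit (y ∷ r)    ≡⟨ cong (_+ deficit (y ∷ r)) (∑-suffixᵣ-∷ x (y ∷ r) x<p) ⟩
    (S′ + suffixᵣ⁺ (y ∷ r) x) + deficit (y ∷ r)  ≡⟨ cong (λ t → (S′ + t) + deficit (y ∷ r)) (suffixᵣ⁺-< y r x x<p) ⟩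
    (S′ + 0) + deficit (y ∷ r)                   ≡⟨ cong (_+ deficit (y ∷ r)) (+-identityʳ S′) ⟩
    S′ + deficit (y ∷ r)                         ≡⟨ ∑-suffixᵣ-initial (y ∷ r) y∷r<p ⟩
    1                                            ∎
    where
    open ≡-Reasoning
    S  = ∑ (p ^ length (x ∷ y ∷ r)) (suffixᵣ (x ∷ y ∷ r))
    S′ = ∑ (p ^ length (y ∷ r)) (suffixᵣ (y ∷ r))

  suffixᵣ-periodic : ∀ r → deficit r ≡ 0 → ∀ N c → suffixᵣ r (N + c * p ^ length r) ≡ suffixᵣ r N
  suffixᵣ-periodic []      _         N c = refl
  suffixᵣ-periodic (x ∷ [])    _         N c =
    cong (λ n → if ⌊ x ≟ n ⌋ then 1 else 0) (%-remove-+ʳ N (∣-trans (m∣m*n 1) (n∣m*n c)))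
  suffixᵣ-periodic (x ∷ y ∷ r) deficit≡0 N c =
    cong₂ (λ n t → if ⌊ x ≟ n ⌋ then t else 0) (%-remove-+ʳ N (∣-trans (m∣m*n P) (n∣m*n c)))
          (step (p ≤? N) (suffixᵣ-periodic (y ∷ r) (m+n≡0⇒n≡0 (suffixᵣ (y ∷ r) 0) deficit≡0) (N / p) c))
    where
    P  = p ^ length (y ∷ r)
    N′ = N + c * (p * P)
    s = suffixᵣ (y ∷ r)
    quotient : N′ / p ≡ N / p + c * P
    quotient = trans (cong (λ n → (N + n) / p) (solve 3 (λ c p q → c :* (p :* q) := c :* q :* p) refl c p P))
                     (quotient-+ N (c * P))
    step : Dec (p ≤ N) → s (N / p + c * P) ≡ s (N / p) → suffixᵣ⁺ (y ∷ r) N′ ≡ suffixᵣ⁺ (y ∷ r) N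
    step (yes p≤N) ih = begin
      (if ⌊ p ≤? N′ ⌋ then s (N′ / p) else 0)  ≡⟨ if-yes (p ≤? N′) (≤-trans p≤N (m≤m+n N _)) ⟩
      s (N′ / p)                              ≡⟨ trans (cong s quotient) ih ⟩
      s (N / p)                               ≡⟨ if-yes (p ≤? N) p≤N ⟨
      (if ⌊ p ≤? N ⌋ then s (N / p) else 0)   ∎
      where open ≡-Reasoning
    step (no p≰N) ih = begin
      (if ⌊ p ≤? N′ ⌋ then s (N′ / p) else 0)  ≡⟨ cong (λ t → if ⌊ p ≤? N′ ⌋ then t else 0) vanish ⟩
      (if ⌊ p ≤? N′ ⌋ then 0 else 0)          ≡⟨ if-same ⌊ p ≤? N′ ⌋ ⟩
      0                                       ≡⟨ if-no (p ≤? N) p≰N ⟨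
      (if ⌊ p ≤? N ⌋ then s (N / p) else 0)   ∎
      where
      open ≡-Reasoning
      vanish : s (N′ / p) ≡ 0
      vanish = begin
        s (N′ / p)   ≡⟨ trans (cong s quotient) ih ⟩
        s (N / p)    ≡⟨ cong s (m<n⇒m/n≡0 (≰⇒> p≰N)) ⟩
        s 0          ≡⟨ m+n≡0⇒m≡0 (s 0) deficit≡0 ⟩
        0            ∎

  suffixᵣ-0 : ∀ r → ¬ r ≡ [] → ¬ r ≡ 0 ∷ [] → suffixᵣ r 0 ≡ 0
  suffixᵣ-0 []          r≢[] _     = ⊥-elim (r≢[] refl)
  suffixᵣ-0 (x ∷ [])    _    r≢[0] = if-no (x ≟ 0 % p) (λ x≡0%p → r≢[0] (cong (_∷ []) (trans x≡0%p (m<n⇒m%n≡m 0<p))))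
  suffixᵣ-0 (x ∷ y ∷ r) _    _     =
    trans (cong (λ t → if ⌊ x ≟ 0 % p ⌋ then t else 0) (suffixᵣ⁺-< y r 0 0<p)) (if-same _)

  ∑-suffixᵣ-blocks : ∀ r → All (_< p) r → ∀ i → ∑ (i * p ^ length r) (λ j → suffixᵣ r (p ^ length r + j)) ≡ i
  ∑-suffixᵣ-blocks r r<p i = begin
    ∑ (i * P) (λ j → suffixᵣ r (P + j))
      ≡⟨ ∑-* i P _ ⟩
    ∑ i (λ c → ∑ P (λ d → suffixᵣ r (P + (c * P + d))))
      ≡⟨ ∑-cong i (λ c _ → ∑-cong P (λ d _ → cong (suffixᵣ r) (+-assoc P (c * P) d))) ⟨
    ∑ i (λ c → ∑ P (λ d → suffixᵣ r (suc c * P + d)))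
      ≡⟨ ∑-cong i (λ c _ → ∑-suffixᵣ-block r r<p (suc c) z<s) ⟩
    ∑ i (λ _ → 1)                                          ≡⟨ ∑-const i 1 ⟩
    i * 1                                                  ≡⟨ *-identityʳ i ⟩
    i                                                      ∎
    where
    open ≡-Reasoning
    P = p ^ length r

  ∑-suffixᵣ-from-0 : ∀ r → All (_< p) r → ∀ i →
    ∑ (suc i * p ^ length r) (suffixᵣ r) ≡ ∑ (p ^ length r) (suffixᵣ r) + i
  ∑-suffixᵣ-from-0 r r<p i =
    trans (∑-+ (p ^ length r) (i * p ^ length r) (suffixᵣ r)) (cong (_ +_) (∑-suffixᵣ-blocks r r<p i))

module Aperiodicity (p : ℕ) .{{_ : NonZero p}} (1<p : 1 < p) (w : List ℕ) (w≢[] : ¬ w ≡ []) (w<p : All (_< p) w) where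
  open Congruence p
  open Digits p 1<p
  open Occurrences w w≢[]

  Periodic : ℕ → Set
  Periodic L = ∀ n → n < p * L → e p w (L + n) ≈ e p w n

  Periodic-iterate : ∀ {L} → Periodic L → ∀ q n → q * L + n < p * L + L → e p w (q * L + n) ≈ e p w n
  Periodic-iterate     per zero    n _   = refl
  Periodic-iterate {L} per (suc q) n bnd = begin
    e p w ((L + q * L) + n) % p  ≡⟨ cong (λ k → e p w k % p) (+-assoc L (q * L) n) ⟩
    e p w (L + (q * L + n)) % p  ≡⟨ per (q * L + n) (+-cancelʳ-< L _ _ bnd′) ⟩
    e p w (q * L + n) % p        ≡⟨ Periodic-iterate per q n (<-≤-trans (+-cancelʳ-< L _ _ bnd′) (m≤m+n (p * L) L)) ⟩
    e p w n % p                  ∎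
    where
    open ≡-Reasoning
    bnd′ : (q * L + n) + L < p * L + L
    bnd′ = subst (_< p * L + L) (solve 3 (λ L q n → (L :+ q :* L) :+ n := (q :* L :+ n) :+ L) refl L q n) bnd

  Periodic-shift : ∀ {L} → Periodic L → ∀ T q d → T ≤ L → q < p → d < L → e p w (T + (q * L + d)) ≈ e p w (T + d)
  Periodic-shift {L} per T q d T≤L q<p d<L = trans (cong (λ k → e p w k % p) regroup) (Periodic-iterate per q (T + d) bound)
    where
    open ≤-Reasoning
    regroup : T + (q * L + d) ≡ q * L + (T + d)
    regroup = solve 4 (λ T q L d → T :+ (q :* L :+ d) := q :* L :+ (T :+ d)) refl T q L d
    bound : q * L + (T + d) < p * L + L
    bound = begin-strict
      q * L + (T + d)  <⟨ +-monoʳ-< (q * L) (+-mono-≤-< T≤L d<L) ⟩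
      q * L + (L + L)  ≡⟨ solve 2 (λ q L → q :* L :+ (L :+ L) := (con 1 :+ q) :* L :+ L) refl q L ⟩
      suc q * L + L    ≤⟨ +-monoˡ-≤ L (*-monoˡ-≤ L q<p) ⟩
      p * L + L        ∎

  ∑-window≈0 : ∀ {L} → Periodic L → ∀ T → T ≤ L → ∑ (p * L) (λ j → e p w (T + j)) ≈ 0
  ∑-window≈0 {L} per T T≤L = begin
    ∑ (p * L) (λ j → e p w (T + j)) % p
      ≡⟨ cong (_% p) (∑-* p L _) ⟩
    ∑ p (λ q → ∑ L (λ d → e p w (T + (q * L + d)))) % p
      ≡⟨ ∑-≈ p (λ q q<p → ∑-≈ L (λ d d<L → Periodic-shift per T q d T≤L q<p d<L)) ⟩
    ∑ p (λ q → ∑ L (λ d → e p w (T + d))) % p           ≡⟨ cong (_% p) (∑-const p _) ⟩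
    (p * ∑ L (λ d → e p w (T + d))) % p                 ≡⟨ p*-≈0 _ ⟩
    0 % p                                               ∎
    where open ≡-Reasoning

  r = reverse w
  m = length w ∸ 1
  P = p ^ length r

  r<p : All (_< p) r
  r<p = All-resp-↭ (↭-sym (↭-reverse w)) w<p

  P≡p*p^m : P ≡ p * p ^ m
  P≡p*p^m = cong (p ^_) (trans (length-reverse w) (nonempty-length w w≢[]))
    where
    nonempty-length : ∀ (u : List ℕ) → ¬ u ≡ [] → length u ≡ suc (length u ∸ 1)
    nonempty-length []      u≢[] = ⊥-elim (u≢[] refl)
    nonempty-length (_ ∷ _) _    = refl

  window≡ : ∀ i → p * (i * p ^ m) ≡ i * P
  window≡ i = trans (solve 3 (λ p i q → p :* (i :* q) := i :* (p :* q)) refl p i (p ^ m)) (cong (i *_) (sym P≡p*p^m))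

  module _ (s0≡0 : suffixᵣ r 0 ≡ 0) where

    ∑-e≈∑-suffixᵣ : ∀ A X → ∑ (p * X) (λ j → e p w (p * A + j)) ≈ ∑ (p * X) (λ j → suffixᵣ r (p * A + j))
    ∑-e≈∑-suffixᵣ A X = begin
      ∑ (p * X) (λ j → e p w (p * A + j)) % p
        ≡⟨ cong (_% p) (∑-digits 0 X _) ⟩
      ∑ X (λ q → ∑ p (λ d → e p w (p * A + (q * p + d)))) % p
        ≡⟨ ∑-≈ X (λ q _ → digit-class q) ⟩
      ∑ X (λ q → ∑ p (λ d → suffixᵣ r (p * A + (q * p + d)))) % p
        ≡⟨ cong (_% p) (∑-digits 0 X _) ⟨
      ∑ (p * X) (λ j → suffixᵣ r (p * A + j)) % p ∎
      where
      open ≡-Reasoning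
      -- The p numbers (A + q) p + d share the quotient A + q, so the recurrence adds p · e (A + q) ≈ 0.
      digit-class : ∀ q → ∑ p (λ d → e p w (p * A + (q * p + d))) ≈ ∑ p (λ d → suffixᵣ r (p * A + (q * p + d)))
      digit-class q = begin
        ∑ p (λ d → e p w (p * A + (q * p + d))) % p
          ≡⟨ cong (_% p) (∑-cong p (λ d d<p → e-step d d<p)) ⟩
        ∑ p (λ d → e p w (A + q) + suffixᵣ r (p * A + (q * p + d))) % p
          ≡⟨ cong (_% p) (∑-distrib p (λ _ → e p w (A + q)) _) ⟩
        (∑ p (λ _ → e p w (A + q)) + ∑ p (λ d → suffixᵣ r (p * A + (q * p + d)))) % p
          ≡⟨ +-≈ (trans (cong (_% p) (∑-const p (e p w (A + q)))) (p*-≈0 (e p w (A + q)))) refl ⟩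
        (0 + ∑ p (λ d → suffixᵣ r (p * A + (q * p + d)))) % p ∎
        where
        regroup : ∀ d → p * A + (q * p + d) ≡ (A + q) * p + d
        regroup d = solve 4 (λ p A q d → p :* A :+ (q :* p :+ d) := (A :+ q) :* p :+ d) refl p A q d
        e-step : ∀ d → d < p → e p w (p * A + (q * p + d)) ≡ e p w (A + q) + suffixᵣ r (p * A + (q * p + d))
        e-step d d<p = begin
          e p w (p * A + (q * p + d))                   ≡⟨ cong (e p w) (regroup d) ⟩
          e p w ((A + q) * p + d)                       ≡⟨ e-digit s0≡0 (A + q) d d<p ⟩
          e p w (A + q) + suffixᵣ r ((A + q) * p + d)   ≡⟨ cong (λ k → e p w (A + q) + suffixᵣ r k) (regroup d) ⟨
          e p w (A + q) + suffixᵣ r (p * A + (q * p + d)) ∎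

    ∑-window-suffixᵣ≈0 : ∀ {L} → Periodic L → ∀ A → p * A ≤ L → ∑ (p * L) (λ j → suffixᵣ r (p * A + j)) ≈ 0
    ∑-window-suffixᵣ≈0 {L} per A pA≤L = trans (sym (∑-e≈∑-suffixᵣ A L)) (∑-window≈0 per (p * A) pA≤L)

    ∑-suffixᵣ-from-0≈0 : ∀ i → Periodic (suc i * p ^ m) → ∑ P (suffixᵣ r) + i ≈ 0
    ∑-suffixᵣ-from-0≈0 i per = begin
      (∑ P (suffixᵣ r) + i) % p
        ≡⟨ cong (_% p) (∑-suffixᵣ-from-0 r r<p i) ⟨
      ∑ (suc i * P) (suffixᵣ r) % p
        ≡⟨ cong (λ n → ∑ n (suffixᵣ r) % p) (window≡ (suc i)) ⟨
      ∑ (p * L) (suffixᵣ r) % p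
        ≡⟨ cong (_% p) (∑-cong (p * L) (λ j _ → cong (λ a → suffixᵣ r (a + j)) (*-zeroʳ p))) ⟨
      ∑ (p * L) (λ j → suffixᵣ r (p * 0 + j)) % p
        ≡⟨ ∑-window-suffixᵣ≈0 per 0 (subst (_≤ L) (sym (*-zeroʳ p)) z≤n) ⟩
      0 % p ∎
      where
      open ≡-Reasoning
      L = suc i * p ^ m

    ∑-suffixᵣ-from-P≈0 : ∀ i → p ≤ i → Periodic (i * p ^ m) → i ≈ 0
    ∑-suffixᵣ-from-P≈0 i p≤i per = begin
      i % p
        ≡⟨ cong (_% p) (∑-suffixᵣ-blocks r r<p i) ⟨
      ∑ (i * P) (λ j → suffixᵣ r (P + j)) % p
        ≡⟨ cong₂ (λ n a → ∑ n (λ j → suffixᵣ r (a + j)) % p) (window≡ i) (sym P≡p*p^m) ⟨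
      ∑ (p * (i * p ^ m)) (λ j → suffixᵣ r (p * p ^ m + j)) % p
        ≡⟨ ∑-window-suffixᵣ≈0 per (p ^ m) (*-monoˡ-≤ (p ^ m) p≤i) ⟩
      0 % p ∎
      where open ≡-Reasoning

    -- A positive deficit means no number below P ends with w, so the windows at 0 and at P
    -- contain i - 1 and i such numbers.
    leading-zero-aperiodic : ∀ t → deficit r ≡ suc t → ∀ i → p ≤ i → ¬ Periodic (i * p ^ m)
    leading-zero-aperiodic t deficit≡1+t zero    p≤0 _   = <⇒≱ 0<p p≤0
    leading-zero-aperiodic t deficit≡1+t (suc i) p≤i per = 1≉0 1<p (+-cancelʳ-≈ 1 0 i 1+i≈i)
      where
      S≡0 : ∑ P (suffixᵣ r) ≡ 0
      S≡0 = m+n≡0⇒m≡0 _ (suc-injective (trans (sym (+-suc _ t))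
              (trans (cong (∑ P (suffixᵣ r) +_) (sym deficit≡1+t)) (∑-suffixᵣ-initial r r<p))))
      i≈0 : i ≈ 0
      i≈0 = trans (cong (λ S → (S + i) % p) (sym S≡0)) (∑-suffixᵣ-from-0≈0 i per)
      1+i≈i : 1 + i ≈ 0 + i
      1+i≈i = trans (∑-suffixᵣ-from-P≈0 (suc i) p≤i per) (sym i≈0)

    Periodic-descend : deficit r ≡ 0 → ∀ c → Periodic (c * P) → Periodic (c * p ^ m)
    Periodic-descend deficit≡0 c per n n<pL = +-cancelʳ-≈ (e p w (L + n)) (e p w n) (suffixᵣ r X) (begin
      (e p w (L + n) + suffixᵣ r X) % p               ≡⟨ cong (λ k → (e p w (L + n) + k) % p) suffixᵣ-shift ⟨
      (e p w (L + n) + suffixᵣ r ((L + n) * p + 0)) % p ≡⟨ cong (_% p) (e-digit s0≡0 (L + n) 0 0<p) ⟨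
      e p w ((L + n) * p + 0) % p                     ≡⟨ cong (λ k → e p w k % p) regroup ⟩
      e p w (c * P + X) % p                           ≡⟨ per X X<p*cP ⟩
      e p w X % p                                     ≡⟨ cong (_% p) (e-digit s0≡0 n 0 0<p) ⟩
      (e p w n + suffixᵣ r X) % p                     ∎)
      where
      open ≡-Reasoning
      L = c * p ^ m
      X = n * p + 0
      regroup : (L + n) * p + 0 ≡ c * P + X
      regroup = trans (solve 4 (λ c q n p → (c :* q :+ n) :* p :+ con 0 := c :* (p :* q) :+ (n :* p :+ con 0)) refl c (p ^ m) n p)
                      (cong (λ k → c * k + X) (sym P≡p*p^m))
      suffixᵣ-shift : suffixᵣ r ((L + n) * p + 0) ≡ suffixᵣ r X
      suffixᵣ-shift = trans (cong (suffixᵣ r) (trans regroup (+-comm (c * P) X))) (suffixᵣ-periodic r deficit≡0 X c)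
      X<p*cP : X < p * (c * P)
      X<p*cP = subst₂ _<_ (sym (+-identityʳ (n * p))) scale (*-monoˡ-< p n<pL)
        where
        scale : p * L * p ≡ p * (c * P)
        scale = trans (solve 3 (λ p c q → p :* (c :* q) :* p := p :* (c :* (p :* q))) refl p c (p ^ m))
                      (cong (λ k → p * (c * k)) (sym P≡p*p^m))

    descent-aperiodic : deficit r ≡ 0 → ∀ i → 0 < i → ¬ Periodic (i * p ^ m)
    descent-aperiodic deficit≡0 = <-rec (λ i → 0 < i → ¬ Periodic (i * p ^ m)) step
      where
      step : ∀ i → (∀ {j} → j < i → 0 < j → ¬ Periodic (j * p ^ m)) → 0 < i → ¬ Periodic (i * p ^ m)
      step (suc i) rec _ per = rec c<1+i 0<c (Periodic-descend deficit≡0 c (subst Periodic 1+i≡c*P per))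
        where
        S≡1 : ∑ P (suffixᵣ r) ≡ 1
        S≡1 = trans (sym (+-identityʳ _)) (trans (cong (∑ P (suffixᵣ r) +_) (sym deficit≡0)) (∑-suffixᵣ-initial r r<p))
        1+i≈0 : suc i ≈ 0
        1+i≈0 = trans (cong (λ S → (S + i) % p) (sym S≡1)) (∑-suffixᵣ-from-0≈0 i per)
        c = suc i / p
        1+i≡c*p : suc i ≡ c * p
        1+i≡c*p = trans (m≡m%n+[m/n]*n (suc i) p) (cong (_+ c * p) (trans 1+i≈0 (m<n⇒m%n≡m 0<p)))
        0<c : 0 < c
        0<c = n≢0⇒n>0 (λ c≡0 → case trans 1+i≡c*p (cong (_* p) c≡0) of λ ())
        c<1+i : c < suc i
        c<1+i = m/n<m (suc i) p 1<p
        1+i≡c*P : suc i * p ^ m ≡ c * P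
        1+i≡c*P = trans (cong (_* p ^ m) 1+i≡c*p)
                        (trans (*-assoc c p (p ^ m)) (cong (c *_) (sym P≡p*p^m)))

  zero-word-aperiodic : w ≡ 0 ∷ [] → ∀ L → 0 < L → ¬ Periodic L
  zero-word-aperiodic refl L 0<L per = 1≉0 1<p (+-cancelʳ-≈ 1 0 (e p w L) (begin
    (1 + e p w L) % p                ≡⟨ cong (_% p) (+-comm 1 (e p w L)) ⟩
    (e p w L + 1) % p                ≡⟨ cong (_% p) e-Lp ⟨
    e p w (L * p) % p                ≡⟨ cong (λ k → e p w k % p) Lp≡ ⟩
    e p w ((p ∸ 1) * L + L) % p      ≡⟨ Periodic-iterate per (p ∸ 1) L (subst (_< p * L + L) (sym Lp≡′) (m<m+n (p * L) 0<L)) ⟩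
    e p w L % p                      ∎))
    where
    open ≡-Reasoning
    Lp≡′ : (p ∸ 1) * L + L ≡ p * L
    Lp≡′ = trans (+-comm _ L) (cong (_* L) (suc-pred p))
    Lp≡ : L * p ≡ (p ∸ 1) * L + L
    Lp≡ = trans (*-comm L p) (sym Lp≡′)
    e-Lp : e p w (L * p) ≡ e p w L + 1
    e-Lp = trans (e-≥ (L * p) (m≤n*m p L {{>-nonZero 0<L}}))
                 (cong₂ _+_ (cong (e p w) (m*n/n≡m L p))
                            (cong (λ k → if ⌊ 0 ≟ k ⌋ then 1 else 0) (m*n%n≡0 L p)))

  suffixᵣ-0≡0 : ¬ w ≡ 0 ∷ [] → suffixᵣ r 0 ≡ 0
  suffixᵣ-0≡0 w≢[0] = suffixᵣ-0 r (λ r≡[] → w≢[] (reverse-injective r≡[])) (λ r≡[0] → w≢[0] (reverse-injective r≡[0]))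

  aperiodic : ∀ i → p ≤ i → ¬ Periodic (i * p ^ m)
  aperiodic i p≤i with ≡-dec _≟_ w (0 ∷ []) | deficit r in deficit≡
  ... | yes w≡[0] | _     =
    zero-word-aperiodic w≡[0] (i * p ^ m) (>-nonZero⁻¹ _ {{m*n≢0 i (p ^ m) {{>-nonZero (<-≤-trans 0<p p≤i)}} {{m^n≢0 p m}}}})
  ... | no w≢[0]  | zero  = descent-aperiodic (suffixᵣ-0≡0 w≢[0]) deficit≡ i (<-≤-trans 0<p p≤i)
  ... | no w≢[0]  | suc t = leading-zero-aperiodic (suffixᵣ-0≡0 w≢[0]) t deficit≡ i p≤i

proposition10 : (p : ℕ) → .{{_ : NonZero p}} → Prime p →
    (w : List ℕ) → ¬ (w ≡ []) → All (λ d → d < p) w →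
    ¬ (∃[ v ] ∃[ i ] (p + 1 ≤ i × length v ≡ i * p ^ (length w ∸ 1)
        × HasPrefix (a p w) (pow v (p + 1))))
proposition10 p p-prime w w≢[] w<p (v , i , p+1≤i , |v|≡ , prefix) = aperiodic i p≤i (subst Periodic |v|≡ periodic)
  where
  1<p : 1 < p
  1<p = nonTrivial⇒n>1 p {{prime⇒nonTrivial p-prime}}
  open Aperiodicity p 1<p w w≢[] w<p
  p≤i : p ≤ i
  p≤i = ≤-trans (m≤m+n p 1) p+1≤i
  periodic : Periodic (length v)
  periodic = HasPrefix-pow⇒periodic (a p w) v p (subst (λ k → HasPrefix (a p w) (pow v k)) (+-comm p 1) prefix)
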